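{- Let $q$ be a prime power, and let $v_1,\dotsc,v_s\in \mathbb{P}^a(\mathbb{F}_q)$ be $m$-independent points (with fixed representatives in $\mathbb{F}_q^{a+1}$). Let $g$ be chosen uniformly at random among all bihomogeneous polynomials of bidegree $(m,m')$ on $\mathbb{P}^a\times\mathbb{P}^b$ with coefficients in $\mathbb{F}_q$ (i.e. $g\in \mathbb{F}_q[x_0,\dotsc,x_a]_m\otimes \mathbb{F}_q[y_0,\dotsc,y_b]_{m'}$). Then the $s$ random polynomials $g(v_1,y),\dotsc,g(v_s,y)\in \mathbb{F}_q[y_0,\dotsc,y_b]_{m'}$ are mutually independent random variables.
   Context: $\mathbb{F}_q[x_0,\dotsc,x_b]_m$ denotes the space of homogeneous polynomials of degree $m$ in $x_0,\dotsc,x_b$ with coefficients in $\mathbb{F}_q$. For a homogeneous ideal $I\subseteq \overline{\mathbb{F}}_q[x_0,\dotsc,x_b]$, the Hilbert function $H_I(m)$ is the codimension of $I\cap \overline{\mathbb{F}}_q[x_0,\dotsc,x_b]_m$ in $\overline{\mathbb{F}}_q[x_0,\dotsc,x_b]_m$; for a set $V\subseteq\mathbb{P}^b$, $I(V)$ is the ideal of homogeneous polynomials vanishing on $V$. Points $p_1,\dotsc,p_t\in\mathbb{P}^a$ are $m$-dependent if $H_{I(\{p_1,\dotsc,p_t\})}(m)<t$, and $m$-independent otherwise. -}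

module Defs where

open import Level using (0ℓ)
open import Data.Nat as ℕ using (ℕ; zero; suc; _∸_)
open import Data.Bool using (Bool; true; false; _∧_; if_then_else_)
open import Data.List as List using (List; []; _∷_; length; upTo; concatMap; map)
open import Data.Nat.ListAction using (product)
open import Data.List.Relation.Unary.Any using (Any)
open import Data.List.Relation.Unary.AllPairs using (AllPairs)
open import Data.Vec as Vec using (Vec; []; _∷_)
open import Data.Fin using (Fin)
open import Data.Product using (∃; Σ; _×_)
open import Relation.Nullary using (¬_; does)
open import Relation.Binary using (Decidable)
open import Algebra.Bundles using (CommutativeRing)

record FiniteField : Set₁ where
  field
    commRing    : CommutativeRing 0ℓ 0ℓ
  open CommutativeRing commRing public
  field
    _≟_         : Decidable _≈_
    1≉0         : ¬ (1# ≈ 0#)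
    inverse     : ∀ x → ¬ (x ≈ 0#) → ∃ λ y → x * y ≈ 1#
    elements    : List Carrier
    complete    : ∀ x → Any (x ≈_) elements
    distinct    : AllPairs (λ x y → ¬ (x ≈ y)) elements

monos : (n d : ℕ) → List (Vec ℕ n)
monos zero zero = [] ∷ []
monos zero (suc d) = []
monos (suc n) d = concatMap (λ k → map (k ∷_) (monos n (d ∸ k))) (upTo (suc d))

nMon : (n d : ℕ) → ℕ
nMon n d = length (monos n d)

count : ∀ {A : Set} → (A → Bool) → List A → ℕ
count p [] = 0
count p (x ∷ xs) = if p x then suc (count p xs) else count p xs

allFinᵇ : (s : ℕ) → (Fin s → Bool) → Bool
allFinᵇ zero f = true
allFinᵇ (suc s) f = f Fin.zero ∧ allFinᵇ s (λ i → f (Fin.suc i))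
  where import Data.Fin as Fin

prodFin : (s : ℕ) → (Fin s → ℕ) → ℕ
prodFin s f = product (List.tabulate f)

module _ (F : FiniteField) where
  open FiniteField F

  allVecs : (n : ℕ) → List (Vec Carrier n)
  allVecs zero = [] ∷ []
  allVecs (suc n) = concatMap (λ x → map (x ∷_) (allVecs n)) elements

  pow : Carrier → ℕ → Carrier
  pow x zero = 1#
  pow x (suc k) = x * pow x k

  monomial : ∀ {n} → Vec ℕ n → Vec Carrier n → Carrier
  monomial [] [] = 1#
  monomial (e ∷ es) (x ∷ xs) = pow x e * monomial es xs

  sumV : ∀ {k} → Vec Carrier k → Carrier
  sumV = Vec.foldr _ _+_ 0#

  -- Homogeneous polynomials of degree d in n variables, represented by
  -- their coefficient vector with respect to the monomial basis `monos n d`.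
  record HomPoly (n d : ℕ) : Set where
    constructor homPoly
    field coeffs : Vec Carrier (nMon n d)
  open HomPoly public

  eval : ∀ {n d} → HomPoly n d → Vec Carrier n → Carrier
  eval {n} {d} f x = sumV (Vec.zipWith (λ c e → c * monomial e x) (coeffs f) (Vec.fromList (monos n d)))

  -- Bihomogeneous polynomials of bidegree (m , m') in variables x (n of
  -- them) and y (n' of them): coefficient c_{α β} of x^α y^β, i.e.
  -- elements of F[x]_m ⊗ F[y]_m'.
  record BiPoly (n m n' m' : ℕ) : Set where
    constructor biPoly
    field bcoeffs : Vec (Vec Carrier (nMon n' m')) (nMon n m)
  open BiPoly public

  -- g(v , y) ∈ F[y]_m' : the coefficient of y^β is Σ_α c_{α β} v^α
  partialEval : ∀ {n m n' m'} → BiPoly n m n' m' → Vec Carrier n → HomPoly n' m'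
  partialEval {n} {m} {n'} {m'} g v =
    homPoly (Vec.tabulate λ β → sumV (Vec.zipWith (λ row e → Vec.lookup row β * monomial e v) (bcoeffs g) (Vec.fromList (monos n m))))

  -- Points v₁,…,vₛ (given by representatives in F^{a+1}) are m-independent:
  -- H_{I({v_i})}(m) = s.  Since I({v_i}) ∩ S_m is the kernel of the
  -- evaluation map S_m → F^s, f ↦ (f(v_i))_i, this says that this
  -- evaluation map is surjective.
  Independent : ∀ {s} (a m : ℕ) → (Fin s → Vec Carrier (suc a)) → Set
  Independent {s} a m v = ∀ (c : Fin s → Carrier) →
    Σ (HomPoly (suc a) m) λ f → ∀ i → eval f (v i) ≈ c i

  NonZeroVec : ∀ {n} → Vec Carrier n → Set
  NonZeroVec x = ¬ (∀ i → Vec.lookup x i ≈ 0#)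

  _≈ᵇ_ : Carrier → Carrier → Bool
  x ≈ᵇ y = does (x ≟ y)

  polyEqᵇ : ∀ {n d} → HomPoly n d → HomPoly n d → Bool
  polyEqᵇ {n} {d} f h = allFinᵇ (nMon n d) (λ i → Vec.lookup (coeffs f) i ≈ᵇ Vec.lookup (coeffs h) i)

  allVecsOf : ∀ {A : Set} → List A → (n : ℕ) → List (Vec A n)
  allVecsOf xs zero = [] ∷ []
  allVecsOf xs (suc n) = concatMap (λ x → map (x ∷_) (allVecsOf xs n)) xs

  -- the finite sample space: all bihomogeneous polynomials of bidegree
  -- (m , m') on P^a × P^b over F, each listed exactly once
  -- (g is uniformly distributed on this list)
  allBiPolys : (a m b m' : ℕ) → List (BiPoly (suc a) m (suc b) m')
  allBiPolys a m b m' = map biPoly (allVecsOf (allVecs (nMon (suc b) m')) (nMon (suc a) m))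

-- Partial evaluation g ↦ (g(v₁,y), …, g(vₛ,y)) is additive in g, and the y^β-coefficient of
-- g(vᵢ,y) is the value at vᵢ of the x-polynomial formed by the β-column of coefficients of g;
-- so m-independence of the vᵢ makes this map, and each of its components, surjective.  In a
-- finite group every fibre of a surjective homomorphism is a translate of the kernel, hence all
-- fibres have the same size.  With N bihomogeneous g and Q polynomials in y, the joint count is
-- therefore N / Q^s and each marginal count is N / Q, which is the product formula.
module Submission where

open import Level using (0ℓ)
open import Algebra.Bundles using (Group)
open import Algebra.Morphism.Structures using (IsMagmaHomomorphism)
import Algebra.Properties.CommutativeMonoid.Sum
import Algebra.Properties.CommutativeSemigroup
import Algebra.Properties.Group
open import Data.Bool using (Bool; true; false; _∧_; if_then_else_)
open import Data.Bool.Properties using (∧-zeroʳ)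
open import Data.Fin as Fin using (Fin)
open import Data.List using (List; []; _∷_; length; map; concatMap; _++_)
open import Data.List.Properties using (map-cong; length-map)
open import Data.List.Relation.Unary.All as All using (All; []; _∷_)
open import Data.List.Relation.Unary.All.Properties using (All¬⇒¬Any)
open import Data.List.Relation.Unary.AllPairs using (AllPairs; _∷_)
open import Data.List.Relation.Unary.Any using (Any; here; there)
open import Data.Nat using (ℕ; zero; suc; _+_; _*_; _^_)
open import Data.Nat.ListAction using (sum)
open import Data.Nat.Properties using (*-zeroʳ; *-identityʳ; +-commutativeSemigroup; *-commutativeSemigroup)
open import Data.Product using (∃; _,_; proj₁; proj₂)
open import Data.Vec as Vec using (Vec; []; _∷_; zipWith; replicate; lookup; tabulate)
import Data.Vec.Properties as Vec
open import Data.Vec.Relation.Binary.Pointwise.Extensional using (ext; extensional⇒inductive)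
open import Data.Vec.Relation.Binary.Pointwise.Inductive as Pointwise using (Pointwise; []; _∷_)
open import Function using (_∘_)
open import Function.Bundles using (mk⇔)
open import Relation.Binary using (Setoid; Decidable)
open import Relation.Binary.PropositionalEquality
  using (_≡_; refl; sym; trans; cong; cong₂; subst; module ≡-Reasoning)
import Relation.Binary.Properties.Setoid
import Relation.Binary.Reasoning.Setoid as ≈-Reasoning
open import Relation.Nullary using (¬_; does; yes; no; contradiction)
open import Relation.Nullary.Decidable using (does-⇔)

open import Defs

private
  module +-CS = Algebra.Properties.CommutativeSemigroup +-commutativeSemigroup
  module *-CS = Algebra.Properties.CommutativeSemigroup *-commutativeSemigroup

-- Counting in lists

module _ {A : Set} where

  count-cong : ∀ {p q : A → Bool} → (∀ x → p x ≡ q x) → ∀ xs → count p xs ≡ count q xs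
  count-cong         p≗q []       = refl
  count-cong {q = q} p≗q (x ∷ xs) rewrite p≗q x with q x
  ... | true  = cong suc (count-cong p≗q xs)
  ... | false = count-cong p≗q xs

  count-++ : ∀ (p : A → Bool) xs ys → count p (xs ++ ys) ≡ count p xs + count p ys
  count-++ p []       ys = refl
  count-++ p (x ∷ xs) ys with p x
  ... | true  = cong suc (count-++ p xs ys)
  ... | false = count-++ p xs ys

  count-true : ∀ (xs : List A) → count (λ _ → true) xs ≡ length xs
  count-true []       = refl
  count-true (x ∷ xs) = cong suc (count-true xs)

  count-false : ∀ (xs : List A) → count (λ _ → false) xs ≡ 0
  count-false []       = refl
  count-false (x ∷ xs) = count-false xs

  count-∧ˡ : ∀ b (p : A → Bool) xs → count (λ x → b ∧ p x) xs ≡ (if b then count p xs else 0)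
  count-∧ˡ true  p xs = refl
  count-∧ˡ false p xs = count-false xs

  sum-map-const : ∀ (xs : List A) k → sum (map (λ _ → k) xs) ≡ length xs * k
  sum-map-const []       k = refl
  sum-map-const (x ∷ xs) k = cong (k +_) (sum-map-const xs k)

  sum-map-indicator : ∀ (p : A → Bool) xs → sum (map (λ x → if p x then 1 else 0) xs) ≡ count p xs
  sum-map-indicator p []       = refl
  sum-map-indicator p (x ∷ xs) with p x
  ... | true  = cong suc (sum-map-indicator p xs)
  ... | false = sum-map-indicator p xs

  sum-map-if-suc : ∀ (p : A → Bool) (f : A → ℕ) xs →
    sum (map (λ x → if p x then suc (f x) else f x) xs) ≡ count p xs + sum (map f xs)
  sum-map-if-suc p f []       = refl
  sum-map-if-suc p f (x ∷ xs) with p x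
  ... | true  = cong suc (trans (cong (f x +_) (sum-map-if-suc p f xs)) (+-CS.x∙yz≈y∙xz (f x) _ (sum (map f xs))))
  ... | false = trans (cong (f x +_) (sum-map-if-suc p f xs)) (+-CS.x∙yz≈y∙xz (f x) _ (sum (map f xs)))

module _ {A B : Set} where

  count-map : ∀ (p : B → Bool) (f : A → B) xs → count p (map f xs) ≡ count (p ∘ f) xs
  count-map p f []       = refl
  count-map p f (x ∷ xs) with p (f x)
  ... | true  = cong suc (count-map p f xs)
  ... | false = count-map p f xs

  double-counting : ∀ (R : A → B → Bool) xs ys →
    sum (map (λ x → count (R x) ys) xs) ≡ sum (map (λ y → count (λ x → R x y) xs) ys)
  double-counting R []       ys = sym (trans (sum-map-const ys 0) (*-zeroʳ (length ys)))
  double-counting R (x ∷ xs) ys = begin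
    count (R x) ys + sum (map (λ x → count (R x) ys) xs)
      ≡⟨ cong (count (R x) ys +_) (double-counting R xs ys) ⟩
    count (R x) ys + sum (map (λ y → count (λ x → R x y) xs) ys)
      ≡⟨ sum-map-if-suc (R x) _ ys ⟨
    sum (map (λ y → count (λ x′ → R x′ y) (x ∷ xs)) ys)
      ∎
    where open ≡-Reasoning

  length-by-fibres : ∀ (R : A → B → Bool) xs ys {k} →
    (∀ x → count (R x) ys ≡ 1) → (∀ y → count (λ x → R x y) xs ≡ k) → length ys * k ≡ length xs
  length-by-fibres R xs ys {k} unique fibre = begin
    length ys * k                                ≡⟨ sum-map-const ys k ⟨
    sum (map (λ _ → k) ys)                       ≡⟨ cong sum (map-cong (sym ∘ fibre) ys) ⟩
    sum (map (λ y → count (λ x → R x y) xs) ys)  ≡⟨ double-counting R xs ys ⟨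
    sum (map (λ x → count (R x) ys) xs)          ≡⟨ cong sum (map-cong unique xs) ⟩
    sum (map (λ _ → 1) xs)                       ≡⟨ sum-map-const xs 1 ⟩
    length xs * 1                                ≡⟨ *-identityʳ (length xs) ⟩
    length xs                                    ∎
    where open ≡-Reasoning

module _ {A B C : Set} where

  count-cartesian : ∀ (p : A → Bool) (q : B → Bool) (r : C → Bool) (f : A → B → C) →
    (∀ x y → r (f x y) ≡ p x ∧ q y) →
    ∀ xs ys → count r (concatMap (λ x → map (f x) ys) xs) ≡ count p xs * count q ys
  count-cartesian p q r f r≡p∧q []       ys = refl
  count-cartesian p q r f r≡p∧q (x ∷ xs) ys = begin
    count r (map (f x) ys ++ rows)
      ≡⟨ count-++ r (map (f x) ys) rows ⟩
    count r (map (f x) ys) + count r rows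
      ≡⟨ cong₂ _+_ (count-map r (f x) ys) (count-cartesian p q r f r≡p∧q xs ys) ⟩
    count (r ∘ f x) ys + count p xs * count q ys
      ≡⟨ cong (_+ count p xs * count q ys) (trans (count-cong (r≡p∧q x) ys) (count-∧ˡ (p x) q ys)) ⟩
    (if p x then count q ys else 0) + count p xs * count q ys
      ≡⟨ add-row (p x) ⟩
    count p (x ∷ xs) * count q ys
      ∎
    where
    open ≡-Reasoning
    rows = concatMap (λ x → map (f x) ys) xs
    add-row : ∀ b → (if b then count q ys else 0) + count p xs * count q ys
                  ≡ (if b then suc (count p xs) else count p xs) * count q ys
    add-row true  = refl
    add-row false = refl

n^s≡q^s*prodFin : ∀ s {q n} (c : Fin s → ℕ) → (∀ i → q * c i ≡ n) → n ^ s ≡ q ^ s * prodFin s c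
n^s≡q^s*prodFin zero            c q*c≡n = refl
n^s≡q^s*prodFin (suc s) {q} {n} c q*c≡n = begin
  n * n ^ s
    ≡⟨ cong₂ _*_ (sym (q*c≡n Fin.zero)) (n^s≡q^s*prodFin s (c ∘ Fin.suc) (q*c≡n ∘ Fin.suc)) ⟩
  q * c Fin.zero * (q ^ s * prodFin s (c ∘ Fin.suc))
    ≡⟨ *-CS.interchange q (c Fin.zero) (q ^ s) _ ⟩
  q * q ^ s * (c Fin.zero * prodFin s (c ∘ Fin.suc))
    ∎
  where open ≡-Reasoning

k*n^s≡n*prodFin : ∀ s {q n k} (c : Fin s → ℕ) →
  q ^ s * k ≡ n → (∀ i → q * c i ≡ n) → k * n ^ s ≡ n * prodFin s c
k*n^s≡n*prodFin s {q} {n} {k} c q^s*k≡n q*c≡n = begin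
  k * n ^ s                  ≡⟨ cong (k *_) (n^s≡q^s*prodFin s c q*c≡n) ⟩
  k * (q ^ s * prodFin s c)  ≡⟨ *-CS.x∙yz≈yx∙z k (q ^ s) (prodFin s c) ⟩
  q ^ s * k * prodFin s c    ≡⟨ cong (_* prodFin s c) q^s*k≡n ⟩
  n * prodFin s c            ∎
  where open ≡-Reasoning

-- Enumerations of finite setoids

record Enumeration (S : Setoid 0ℓ 0ℓ) : Set where
  open Setoid S
  infix 4 _≟_
  field
    _≟_      : Decidable _≈_
    elements : List Carrier
    once     : ∀ x → count (λ y → does (x ≟ y)) elements ≡ 1

  fibreSize : ∀ {A : Set} → (A → Carrier) → List A → Carrier → ℕ
  fibreSize f xs y = count (λ x → does (f x ≟ y)) xs

open Enumeration using (elements; once; fibreSize)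

module _ {S : Setoid 0ℓ 0ℓ} (_≟_ : Decidable (Setoid._≈_ S)) where
  open Setoid S using (_≈_) renaming (sym to ≈-sym)
  open Relation.Binary.Properties.Setoid S using (≉-respˡ)

  count-none : ∀ {x ys} → All (λ y → ¬ x ≈ y) ys → count (λ y → does (x ≟ y)) ys ≡ 0
  count-none []                     = refl
  count-none {x} (_∷_ {y} x≉y x≉ys) with x ≟ y
  ... | yes x≈y = contradiction x≈y x≉y
  ... | no  _   = count-none x≉ys

  count-once : ∀ {x ys} → Any (x ≈_) ys → AllPairs (λ y z → ¬ y ≈ z) ys →
    count (λ y → does (x ≟ y)) ys ≡ 1
  count-once {x} (here {y} x≈y) (y≉ys ∷ _) with x ≟ y
  ... | yes _   = cong suc (count-none (All.map (≉-respˡ (≈-sym x≈y)) y≉ys))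
  ... | no  x≉y = contradiction x≈y x≉y
  count-once {x} (there {y} x∈ys) (y≉ys ∷ distinct) with x ≟ y
  ... | yes x≈y = contradiction x∈ys (All¬⇒¬Any (All.map (≉-respˡ (≈-sym x≈y)) y≉ys))
  ... | no  _   = count-once x∈ys distinct

module _ {S : Setoid 0ℓ 0ℓ} (E : Enumeration S) where
  open Setoid S using (Carrier; _≈_) renaming (sym to ≈-sym)
  open Enumeration E using (_≟_)

  count-∘-bijection : ∀ {σ : Carrier → Carrier} (q : Carrier → Bool) →
    (∀ {x y} → x ≈ y → q x ≡ q y) → (∀ y → fibreSize E σ (elements E) y ≡ 1) →
    count (q ∘ σ) (elements E) ≡ count q (elements E)
  count-∘-bijection {σ} q q-resp σ-bijective = begin
    count (q ∘ σ) (elements E)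
      ≡⟨ sum-map-indicator (q ∘ σ) (elements E) ⟨
    sum (map (λ x → if q (σ x) then 1 else 0) (elements E))
      ≡⟨ cong sum (map-cong row (elements E)) ⟨
    sum (map (λ x → count (R x) (elements E)) (elements E))
      ≡⟨ double-counting R (elements E) (elements E) ⟩
    sum (map (λ y → count (λ x → R x y) (elements E)) (elements E))
      ≡⟨ cong sum (map-cong column (elements E)) ⟩
    sum (map (λ y → if q y then 1 else 0) (elements E))
      ≡⟨ sum-map-indicator q (elements E) ⟩
    count q (elements E)
      ∎
    where
    open ≡-Reasoning
    R : Carrier → Carrier → Bool
    R x y = q y ∧ does (σ x ≟ y)

    q-resp-∧ : ∀ z y → q y ∧ does (z ≟ y) ≡ q z ∧ does (z ≟ y)
    q-resp-∧ z y with z ≟ y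
    ... | yes z≈y = cong (_∧ true) (q-resp (≈-sym z≈y))
    ... | no  _   = trans (∧-zeroʳ (q y)) (sym (∧-zeroʳ (q z)))

    row : ∀ x → count (R x) (elements E) ≡ (if q (σ x) then 1 else 0)
    row x = begin
      count (R x) (elements E)
        ≡⟨ count-cong (q-resp-∧ (σ x)) (elements E) ⟩
      count (λ y → q (σ x) ∧ does (σ x ≟ y)) (elements E)
        ≡⟨ count-∧ˡ (q (σ x)) _ (elements E) ⟩
      (if q (σ x) then count (λ y → does (σ x ≟ y)) (elements E) else 0)
        ≡⟨ cong (if q (σ x) then_else 0) (once E (σ x)) ⟩
      (if q (σ x) then 1 else 0)
        ∎

    column : ∀ y → count (λ x → R x y) (elements E) ≡ (if q y then 1 else 0)
    column y = trans (count-∧ˡ (q y) _ (elements E)) (cong (if q y then_else 0) (σ-bijective y))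

-- Fibres of group homomorphisms

module _ {G : Group 0ℓ 0ℓ} (EG : Enumeration (Group.setoid G)) where
  open Group G using (_≈_; _∙_; _//_; ∙-congʳ) renaming (refl to ≈-refl; sym to ≈-sym; trans to ≈-trans)
  open Algebra.Properties.Group G using (//-rightDividesˡ; //-rightDividesʳ; //-cong₂)

  fibreSize-∙ʳ : ∀ g y → fibreSize EG (_∙ g) (elements EG) y ≡ 1
  fibreSize-∙ʳ g y =
    trans (count-cong (λ x → does-⇔ (mk⇔ (to x) (from x)) (x ∙ g ≟ y) (y // g ≟ x)) (elements EG))
          (once EG (y // g))
    where
    open Enumeration EG using (_≟_)
    to : ∀ x → x ∙ g ≈ y → y // g ≈ x
    to x xg≈y = ≈-trans (//-cong₂ (≈-sym xg≈y) ≈-refl) (//-rightDividesʳ g x)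
    from : ∀ x → y // g ≈ x → x ∙ g ≈ y
    from x y/g≈x = ≈-trans (∙-congʳ (≈-sym y/g≈x)) (//-rightDividesˡ g y)

module _ {G H : Group 0ℓ 0ℓ} (EG : Enumeration (Group.setoid G)) (EH : Enumeration (Group.setoid H))
         {φ : Group.Carrier G → Group.Carrier H}
         (φ-homo : IsMagmaHomomorphism (Group.rawMagma G) (Group.rawMagma H) φ)
         (φ-surjective : ∀ y → ∃ λ x → Group._≈_ H (φ x) y) where
  private
    module G = Group G
    module H = Group H
  open Enumeration EH using (_≟_)
  open IsMagmaHomomorphism φ-homo using (⟦⟧-cong; homo)
  open Algebra.Properties.Group H using (identityˡ-unique)

  -- Right translation by a preimage of y maps the kernel onto the fibre over y.
  fibreSize≡fibreSize-ε : ∀ y → fibreSize EH φ (elements EG) y ≡ fibreSize EH φ (elements EG) H.ε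
  fibreSize≡fibreSize-ε y = begin
    fibreSize EH φ (elements EG) y
      ≡⟨ count-∘-bijection EG _ φ-fibre-resp (fibreSize-∙ʳ {G = G} EG g) ⟨
    fibreSize EH (φ ∘ (G._∙ g)) (elements EG) y
      ≡⟨ count-cong (λ x → does-⇔ (mk⇔ (to x) (from x)) (φ (x G.∙ g) ≟ y) (φ x ≟ H.ε)) (elements EG) ⟩
    fibreSize EH φ (elements EG) H.ε
      ∎
    where
    open ≡-Reasoning
    g = proj₁ (φ-surjective y)
    φg≈y = proj₂ (φ-surjective y)
    φ-fibre-resp : ∀ {x x′} → x G.≈ x′ → does (φ x ≟ y) ≡ does (φ x′ ≟ y)
    φ-fibre-resp {x} {x′} x≈x′ =
      does-⇔ (mk⇔ (H.trans (⟦⟧-cong (G.sym x≈x′))) (H.trans (⟦⟧-cong x≈x′))) (φ x ≟ y) (φ x′ ≟ y)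
    φxg≈φx∙y : ∀ x → φ (x G.∙ g) H.≈ φ x H.∙ y
    φxg≈φx∙y x = H.trans (homo x g) (H.∙-congˡ φg≈y)
    to : ∀ x → φ (x G.∙ g) H.≈ y → φ x H.≈ H.ε
    to x φxg≈y = identityˡ-unique (φ x) y (H.trans (H.sym (φxg≈φx∙y x)) φxg≈y)
    from : ∀ x → φ x H.≈ H.ε → φ (x G.∙ g) H.≈ y
    from x φx≈ε = H.trans (φxg≈φx∙y x) (H.trans (H.∙-congʳ φx≈ε) (H.identityˡ y))

  length*fibreSize≡length : ∀ y → length (elements EH) * fibreSize EH φ (elements EG) y ≡ length (elements EG)
  length*fibreSize≡length y =
    trans (cong (length (elements EH) *_) (fibreSize≡fibreSize-ε y))
          (length-by-fibres (λ x y → does (φ x ≟ y)) (elements EG) (elements EH) (once EH ∘ φ) fibreSize≡fibreSize-ε)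

-- Vectors over a group

module _ (G : Group 0ℓ 0ℓ) where
  open Group G

  zipWith-inverseˡ : ∀ {n} (xs : Vec Carrier n) → Pointwise _≈_ (zipWith _∙_ (Vec.map _⁻¹ xs) xs) (replicate n ε)
  zipWith-inverseˡ []       = []
  zipWith-inverseˡ (x ∷ xs) = inverseˡ x ∷ zipWith-inverseˡ xs

  zipWith-inverseʳ : ∀ {n} (xs : Vec Carrier n) → Pointwise _≈_ (zipWith _∙_ xs (Vec.map _⁻¹ xs)) (replicate n ε)
  zipWith-inverseʳ []       = []
  zipWith-inverseʳ (x ∷ xs) = inverseʳ x ∷ zipWith-inverseʳ xs

  vecGroup : ℕ → Group 0ℓ 0ℓ
  vecGroup n = record
    { Carrier = Vec Carrier n
    ; _≈_     = Pointwise _≈_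
    ; _∙_     = zipWith _∙_
    ; ε       = replicate n ε
    ; _⁻¹     = Vec.map _⁻¹
    ; isGroup = record
      { isMonoid = record
        { isSemigroup = record
          { isMagma = record
            { isEquivalence = Pointwise.isEquivalence isEquivalence n
            ; ∙-cong        = Pointwise.zipWith-cong ∙-cong
            }
          ; assoc = Pointwise.zipWith-assoc assoc
          }
        ; identity = Pointwise.zipWith-identityˡ identityˡ , Pointwise.zipWith-identityʳ identityʳ
        }
      ; inverse = zipWith-inverseˡ , zipWith-inverseʳ
      ; ⁻¹-cong = Pointwise.map⁺ ⁻¹-cong
      }
    }

module _ {A : Set} {_∼_ : A → A → Set} where

  lookup⁻ : ∀ {n} {xs ys : Vec A n} → (∀ i → lookup xs i ∼ lookup ys i) → Pointwise _∼_ xs ys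
  lookup⁻ = extensional⇒inductive ∘ ext

  module _ (_≟_ : Decidable _∼_) where

    allFinᵇ-lookup : ∀ {n} (xs ys : Vec A n) →
      allFinᵇ n (λ i → does (lookup xs i ≟ lookup ys i)) ≡ does (Pointwise.decidable _≟_ xs ys)
    allFinᵇ-lookup []       []       = refl
    allFinᵇ-lookup (x ∷ xs) (y ∷ ys) = cong (does (x ≟ y) ∧_) (allFinᵇ-lookup xs ys)

    allFinᵇ-tabulate : ∀ n {p : Fin n → Bool} {f g : Fin n → A} → (∀ i → p i ≡ does (f i ≟ g i)) →
      allFinᵇ n p ≡ does (Pointwise.decidable _≟_ (tabulate f) (tabulate g))
    allFinᵇ-tabulate zero    p≡ = refl
    allFinᵇ-tabulate (suc n) p≡ = cong₂ _∧_ (p≡ Fin.zero) (allFinᵇ-tabulate n (p≡ ∘ Fin.suc))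

lookup²∘tabulate² : ∀ {A : Set} {m n} (f : Fin m → Fin n → A) i j →
  lookup (lookup (tabulate (λ i → tabulate (f i))) i) j ≡ f i j
lookup²∘tabulate² f i j = trans (cong (λ row → lookup row j) (Vec.lookup∘tabulate _ i)) (Vec.lookup∘tabulate (f i) j)

zipWith-tabulate : ∀ {A B C : Set} {n} (f : A → B → C) (g : Fin n → A) (h : Fin n → B) →
  zipWith f (tabulate g) (tabulate h) ≡ tabulate (λ i → f (g i) (h i))
zipWith-tabulate {n = zero}  f g h = refl
zipWith-tabulate {n = suc n} f g h = cong (f (g Fin.zero) (h Fin.zero) ∷_) (zipWith-tabulate f (g ∘ Fin.suc) (h ∘ Fin.suc))

module _ {G H : Group 0ℓ 0ℓ} {s} {f : Fin s → Group.Carrier G → Group.Carrier H} where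
  private
    module H = Group H
  open IsMagmaHomomorphism

  tabulate-homomorphism : (∀ i → IsMagmaHomomorphism (Group.rawMagma G) H.rawMagma (f i)) →
    IsMagmaHomomorphism (Group.rawMagma G) (Group.rawMagma (vecGroup H s)) (λ x → tabulate (λ i → f i x))
  tabulate-homomorphism f-homo = record
    { isRelHomomorphism = record { cong = λ x≈y → Pointwise.tabulate⁺ (λ i → ⟦⟧-cong (f-homo i) x≈y) }
    ; homo = λ x y → subst (Pointwise H._≈_ _) (sym (zipWith-tabulate H._∙_ (λ i → f i x) (λ i → f i y)))
                           (Pointwise.tabulate⁺ (λ i → homo (f-homo i) x y))
    }

  tabulate-surjective : (∀ ys → ∃ λ x → Pointwise H._≈_ (tabulate (λ i → f i x)) ys) →
    ∀ i y → ∃ λ x → f i x H.≈ y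
  tabulate-surjective surjective i y =
    x , H.trans (H.reflexive (sym (Vec.lookup∘tabulate (λ j → f j x) i)))
                (H.trans (Pointwise.lookup fx≈y i) (H.reflexive (Vec.lookup-replicate i y)))
    where
    x = proj₁ (surjective (replicate s y))
    fx≈y = proj₂ (surjective (replicate s y))

-- Partial evaluation of bihomogeneous polynomials

module _ (F : FiniteField) where
  open FiniteField F using (Carrier; setoid; _≈_; +-group; +-commutativeMonoid; distribʳ; *-congʳ)
  private
    module F = FiniteField F
  open Algebra.Properties.CommutativeMonoid.Sum +-commutativeMonoid
    using (sum-syntax; ∑-distrib-+; sum-cong-≋; sum-cong-≗)

  vectors : ∀ {S : Setoid 0ℓ 0ℓ} → Enumeration S → ∀ n → Enumeration (Pointwise.setoid S n)
  vectors {S} E n = record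
    { _≟_      = Pointwise.decidable _≟_
    ; elements = allVecsOf F (elements E) n
    ; once     = once-vec n
    }
    where
    open Enumeration E using (_≟_)
    once-vec : ∀ n (xs : Vec (Setoid.Carrier S) n) →
      count (λ ys → does (Pointwise.decidable _≟_ xs ys)) (allVecsOf F (elements E) n) ≡ 1
    once-vec zero    []       = refl
    once-vec (suc n) (x ∷ xs) =
      trans (count-cartesian _ _ _ _∷_ (λ _ _ → refl) (elements E) (allVecsOf F (elements E) n))
            (cong₂ _*_ (once E x) (once-vec n xs))

  length-allVecsOf : ∀ {A : Set} (xs : List A) n → length (allVecsOf F xs n) ≡ length xs ^ n
  length-allVecsOf xs zero    = refl
  length-allVecsOf xs (suc n) = begin
    length (allVecsOf F xs (suc n))
      ≡⟨ count-true (allVecsOf F xs (suc n)) ⟨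
    count (λ _ → true) (allVecsOf F xs (suc n))
      ≡⟨ count-cartesian _ _ _ _∷_ (λ _ _ → refl) xs (allVecsOf F xs n) ⟩
    count (λ _ → true) xs * count (λ _ → true) (allVecsOf F xs n)
      ≡⟨ cong₂ _*_ (count-true xs) (count-true (allVecsOf F xs n)) ⟩
    length xs * length (allVecsOf F xs n)
      ≡⟨ cong (length xs *_) (length-allVecsOf xs n) ⟩
    length xs * length xs ^ n
      ∎
    where open ≡-Reasoning

  scalars : Enumeration setoid
  scalars = record
    { _≟_      = F._≟_
    ; elements = F.elements
    ; once     = λ x → count-once {S = setoid} F._≟_ (F.complete x) F.distinct
    }

  allVecs≡allVecsOf : ∀ n → allVecs F n ≡ allVecsOf F F.elements n
  allVecs≡allVecsOf zero    = refl
  allVecs≡allVecsOf (suc n) = cong (λ xss → concatMap (λ x → map (x ∷_) xss) F.elements) (allVecs≡allVecsOf n)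

  coefficientVectors : ∀ n → Enumeration (Group.setoid (vecGroup +-group n))
  coefficientVectors n = record (vectors scalars n)
    { elements = allVecs F n
    ; once     = λ xs → subst (λ xss → count (λ ys → does (Pointwise.decidable F._≟_ xs ys)) xss ≡ 1)
                              (sym (allVecs≡allVecsOf n)) (once (vectors scalars n) xs)
    }

  sumV-zipWith : ∀ {n} {X Y : Set} (f : X → Y → Carrier) (xs : Vec X n) (ys : Vec Y n) →
    sumV F (zipWith f xs ys) ≡ ∑[ i < n ] f (lookup xs i) (lookup ys i)
  sumV-zipWith f []       []       = refl
  sumV-zipWith f (x ∷ xs) (y ∷ ys) = cong (f x y F.+_) (sumV-zipWith f xs ys)

  module _ (a m b m′ : ℕ) where
    private
      nA = nMon (suc a) m
      nB = nMon (suc b) m′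
      xMonomials = Vec.fromList (monos (suc a) m)

    Coefficients : Group 0ℓ 0ℓ
    Coefficients = vecGroup +-group nB

    BiCoefficients : Group 0ℓ 0ℓ
    BiCoefficients = vecGroup Coefficients nA

    toBiPoly : Vec (Vec Carrier nB) nA → BiPoly F (suc a) m (suc b) m′
    toBiPoly = biPoly

    partialEvalCoeffs : Vec Carrier (suc a) → Vec (Vec Carrier nB) nA → Vec Carrier nB
    partialEvalCoeffs v G = coeffs (partialEval F (toBiPoly G) v)

    -- partialEvalCoeffs v G is definitionally tabulate (λ β → partialEvalCoeff v β G).
    partialEvalCoeff : Vec Carrier (suc a) → Fin nB → Vec (Vec Carrier nB) nA → Carrier
    partialEvalCoeff v β G = sumV F (zipWith (λ row e → lookup row β F.* monomial F e v) G xMonomials)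

    partialEvalCoeff≡∑ : ∀ v β G →
      partialEvalCoeff v β G ≡ ∑[ α < nA ] (lookup (lookup G α) β F.* monomial F (lookup xMonomials α) v)
    partialEvalCoeff≡∑ v β G = sumV-zipWith _ G xMonomials

    partialEvalCoeff-homomorphism : ∀ v β →
      IsMagmaHomomorphism (Group.rawMagma BiCoefficients) (Group.rawMagma +-group) (partialEvalCoeff v β)
    partialEvalCoeff-homomorphism v β = record
      { isRelHomomorphism = record { cong = λ {G} {G′} G≈G′ → begin
          partialEvalCoeff v β G
            ≡⟨ partialEvalCoeff≡∑ v β G ⟩
          ∑[ α < nA ] (entry G α F.* w α)
            ≈⟨ sum-cong-≋ (λ α → *-congʳ (Pointwise.lookup (Pointwise.lookup G≈G′ α) β)) ⟩
          ∑[ α < nA ] (entry G′ α F.* w α)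
            ≡⟨ partialEvalCoeff≡∑ v β G′ ⟨
          partialEvalCoeff v β G′
            ∎ }
      ; homo = λ G G′ → begin
          partialEvalCoeff v β (zipWith (zipWith F._+_) G G′)
            ≡⟨ partialEvalCoeff≡∑ v β (zipWith (zipWith F._+_) G G′) ⟩
          ∑[ α < nA ] (entry (zipWith (zipWith F._+_) G G′) α F.* w α)
            ≡⟨ sum-cong-≗ (λ α → cong (F._* w α) (entry-zipWith G G′ α)) ⟩
          ∑[ α < nA ] ((entry G α F.+ entry G′ α) F.* w α)
            ≈⟨ sum-cong-≋ (λ α → distribʳ (w α) (entry G α) (entry G′ α)) ⟩
          ∑[ α < nA ] (entry G α F.* w α F.+ entry G′ α F.* w α)
            ≈⟨ ∑-distrib-+ (λ α → entry G α F.* w α) (λ α → entry G′ α F.* w α) ⟩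
          ∑[ α < nA ] (entry G α F.* w α) F.+ ∑[ α < nA ] (entry G′ α F.* w α)
            ≡⟨ cong₂ F._+_ (partialEvalCoeff≡∑ v β G) (partialEvalCoeff≡∑ v β G′) ⟨
          partialEvalCoeff v β G F.+ partialEvalCoeff v β G′ ∎
      }
      where
      open ≈-Reasoning setoid
      entry : Vec (Vec Carrier nB) nA → Fin nA → Carrier
      entry G α = lookup (lookup G α) β
      w : Fin nA → Carrier
      w α = monomial F (lookup xMonomials α) v
      entry-zipWith : ∀ G G′ α → entry (zipWith (zipWith F._+_) G G′) α ≡ entry G α F.+ entry G′ α
      entry-zipWith G G′ α = trans (cong (λ row → lookup row β) (Vec.lookup-zipWith (zipWith F._+_) α G G′))
                                   (Vec.lookup-zipWith F._+_ β (lookup G α) (lookup G′ α))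

    partialEvalCoeffs-homomorphism : ∀ v →
      IsMagmaHomomorphism (Group.rawMagma BiCoefficients) (Group.rawMagma Coefficients) (partialEvalCoeffs v)
    partialEvalCoeffs-homomorphism v =
      tabulate-homomorphism {G = BiCoefficients} {H = +-group} (partialEvalCoeff-homomorphism v)

    module _ {s} (v : Fin s → Vec Carrier (suc a)) where

      jointPartialEvalCoeffs : Vec (Vec Carrier nB) nA → Vec (Vec Carrier nB) s
      jointPartialEvalCoeffs G = tabulate (λ i → partialEvalCoeffs (v i) G)

      jointPartialEvalCoeffs-homomorphism :
        IsMagmaHomomorphism (Group.rawMagma BiCoefficients) (Group.rawMagma (vecGroup Coefficients s)) jointPartialEvalCoeffs
      jointPartialEvalCoeffs-homomorphism =
        tabulate-homomorphism {G = BiCoefficients} {H = Coefficients} (partialEvalCoeffs-homomorphism ∘ v)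

      -- For each β, independence gives an x-polynomial f β with the prescribed values T[i][β] at the vᵢ;
      -- its coefficients form the β-column of the preimage.
      jointPartialEvalCoeffs-surjective : Independent F a m v →
        ∀ T → ∃ λ G → Pointwise (Pointwise _≈_) (jointPartialEvalCoeffs G) T
      jointPartialEvalCoeffs-surjective independent T = G , lookup⁻ λ i → lookup⁻ λ β → begin
        lookup (lookup (jointPartialEvalCoeffs G) i) β
          ≡⟨ lookup²∘tabulate² _ i β ⟩
        partialEvalCoeff (v i) β G
          ≡⟨ partialEvalCoeff≡∑ (v i) β G ⟩
        ∑[ α < nA ] (lookup (lookup G α) β F.* w i α)
          ≡⟨ sum-cong-≗ (λ α → cong (F._* w i α) (lookup²∘tabulate² column α β)) ⟩
        ∑[ α < nA ] (lookup (coeffs (f β)) α F.* w i α)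
          ≡⟨ sumV-zipWith _ (coeffs (f β)) xMonomials ⟨
        eval F (f β) (v i)
          ≈⟨ proj₂ (independent (targets β)) i ⟩
        lookup (lookup T i) β
          ∎
        where
        open ≈-Reasoning setoid
        w : Fin s → Fin nA → Carrier
        w i α = monomial F (lookup xMonomials α) (v i)
        targets : Fin nB → Fin s → Carrier
        targets β i = lookup (lookup T i) β
        f : Fin nB → HomPoly F (suc a) m
        f β = proj₁ (independent (targets β))
        column : Fin nA → Fin nB → Carrier
        column α β = lookup (coeffs (f β)) α
        G : Vec (Vec Carrier nB) nA
        G = tabulate (λ α → tabulate (column α))

      coefficientMatrices : List (Vec (Vec Carrier nB) nA)
      coefficientMatrices = allVecsOf F (allVecs F nB) nA

      marginalCount : Fin s → HomPoly F (suc b) m′ → ℕ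
      marginalCount i t = count (λ g → polyEqᵇ F (partialEval F g (v i)) t) (allBiPolys F a m b m′)

      jointCount : (Fin s → HomPoly F (suc b) m′) → ℕ
      jointCount h = count (λ g → allFinᵇ s (λ i → polyEqᵇ F (partialEval F g (v i)) (h i))) (allBiPolys F a m b m′)

      marginalCount≡fibreSize : ∀ i t →
        marginalCount i t ≡ fibreSize (coefficientVectors nB) (partialEvalCoeffs (v i)) coefficientMatrices (coeffs t)
      marginalCount≡fibreSize i t =
        trans (count-map (λ g → polyEqᵇ F (partialEval F g (v i)) t) toBiPoly coefficientMatrices)
              (count-cong (λ G → allFinᵇ-lookup F._≟_ (partialEvalCoeffs (v i) G) (coeffs t)) coefficientMatrices)

      jointCount≡fibreSize : ∀ h →
        jointCount h
          ≡ fibreSize (vectors (coefficientVectors nB) s) jointPartialEvalCoeffs coefficientMatrices (tabulate (coeffs ∘ h))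
      jointCount≡fibreSize h =
        trans (count-map (λ g → allFinᵇ s (λ i → polyEqᵇ F (partialEval F g (v i)) (h i))) toBiPoly coefficientMatrices)
              (count-cong (λ G → allFinᵇ-tabulate (Pointwise.decidable F._≟_) s
                                   (λ i → allFinᵇ-lookup F._≟_ (partialEvalCoeffs (v i) G) (coeffs (h i))))
                          coefficientMatrices)

      module _ (independent : Independent F a m v) where

        marginalCount-uniform : ∀ i t → length (allVecs F nB) * marginalCount i t ≡ length (allBiPolys F a m b m′)
        marginalCount-uniform i t = begin
          length (allVecs F nB) * marginalCount i t
            ≡⟨ cong (length (allVecs F nB) *_) (marginalCount≡fibreSize i t) ⟩
          length (allVecs F nB) * fibreSize (coefficientVectors nB) (partialEvalCoeffs (v i)) coefficientMatrices (coeffs t)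
            ≡⟨ length*fibreSize≡length {G = BiCoefficients} {H = Coefficients}
                 (vectors (coefficientVectors nB) nA) (coefficientVectors nB)
                 (partialEvalCoeffs-homomorphism (v i))
                 (tabulate-surjective {G = BiCoefficients} {H = Coefficients} (jointPartialEvalCoeffs-surjective independent) i)
                 (coeffs t) ⟩
          length coefficientMatrices                     ≡⟨ length-map toBiPoly coefficientMatrices ⟨
          length (allBiPolys F a m b m′)                 ∎
          where open ≡-Reasoning

        jointCount-uniform : ∀ h → length (allVecs F nB) ^ s * jointCount h ≡ length (allBiPolys F a m b m′)
        jointCount-uniform h = begin
          length (allVecs F nB) ^ s * jointCount h
            ≡⟨ cong₂ _*_ (sym (length-allVecsOf (allVecs F nB) s)) (jointCount≡fibreSize h) ⟩
          length (allVecsOf F (allVecs F nB) s)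
            * fibreSize (vectors (coefficientVectors nB) s) jointPartialEvalCoeffs coefficientMatrices (tabulate (coeffs ∘ h))
            ≡⟨ length*fibreSize≡length {G = BiCoefficients} {H = vecGroup Coefficients s}
                 (vectors (coefficientVectors nB) nA) (vectors (coefficientVectors nB) s)
                 jointPartialEvalCoeffs-homomorphism (jointPartialEvalCoeffs-surjective independent) (tabulate (coeffs ∘ h)) ⟩
          length coefficientMatrices                     ≡⟨ length-map toBiPoly coefficientMatrices ⟨
          length (allBiPolys F a m b m′)                 ∎
          where open ≡-Reasoning

proposition11 : (F : FiniteField) (a b m m' s : ℕ)
    → (v : Fin s → Vec (FiniteField.Carrier F) (suc a))
    → (∀ i → NonZeroVec F (v i))
    → Independent F a m v
    → (h : Fin s → HomPoly F (suc b) m')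
    → count (λ g → allFinᵇ s (λ i → polyEqᵇ F (partialEval F g (v i)) (h i)))
            (allBiPolys F a m b m')
        * length (allBiPolys F a m b m') ^ s
      ≡ length (allBiPolys F a m b m')
        * prodFin s (λ i → count (λ g → polyEqᵇ F (partialEval F g (v i)) (h i))
                                 (allBiPolys F a m b m'))
proposition11 F a b m m′ s v _ independent h =
  k*n^s≡n*prodFin s (λ i → marginalCount F a m b m′ v i (h i))
    (jointCount-uniform F a m b m′ v independent h)
    (λ i → marginalCount-uniform F a m b m′ v independent i (h i))
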